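{- For every integer $n \ge 7$, $\mathrm{indsat}(n,\mathrm{paw}) = 0$.
   Context: All graphs are finite and simple. The paw is the graph obtained from $K_{1,3}$ by adding one edge. A trigraph $T$ consists of a finite vertex set $V(T)$ together with a partition of the set of unordered pairs of distinct vertices of $V(T)$ into black edges, white edges and gray edges. A realization of $T$ is a graph with vertex set $V(T)$ whose edge set consists of all black edges together with some subset of the gray edges. For a graph $H$, a trigraph $T$ is $H$-induced-saturated if no realization of $T$ contains an induced subgraph isomorphic to $H$, but for every black or white edge $e$ of $T$, the trigraph obtained from $T$ by changing $e$ to gray has a realization containing an induced subgraph isomorphic to $H$. The induced saturation number $\mathrm{indsat}(n,H)$ is the minimum number of gray edges in an $H$-induced-saturated trigraph on $n$ vertices. -}

module Defs where

open import Data.Nat using (ℕ; _≤_)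
open import Data.Fin using (Fin; toℕ; _≟_)
open import Data.Fin.Patterns using (0F; 1F; 2F; 3F)
open import Data.Bool using (Bool; true; false; _∧_; _∨_; if_then_else_)
open import Data.Bool.Properties using (∨-comm; ∧-comm)
open import Data.List using (List; map; allFin)
open import Data.Nat.ListAction using (sum)
open import Data.Product using (Σ; ∃; _×_; _,_)
open import Data.Sum using (_⊎_)
open import Function.Definitions using (Injective)
open import Relation.Nullary using (¬_)
open import Relation.Nullary.Decidable using (⌊_⌋)
open import Relation.Binary.PropositionalEquality using (_≡_; _≢_; refl; cong₂)
open import Data.Nat using (_<?_)

record Graph (k : ℕ) : Set where
  field
    adj   : Fin k → Fin k → Bool
    sym   : ∀ x y → adj x y ≡ adj y x
    irref : ∀ x → adj x x ≡ false
open Graph public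

record InducedCopy {k n : ℕ} (H : Graph k) (G : Graph n) : Set where
  field
    emb     : Fin k → Fin n
    emb-inj : Injective _≡_ _≡_ emb
    emb-adj : ∀ a b → adj G (emb a) (emb b) ≡ adj H a b
open InducedCopy public

HasInduced : {k n : ℕ} → Graph k → Graph n → Set
HasInduced H G = InducedCopy H G

-- The paw: K_{1,3} with centre 0 and leaves 1,2,3, plus the edge 12.
pawAdj : Fin 4 → Fin 4 → Bool
pawAdj 0F 1F = true
pawAdj 0F 2F = true
pawAdj 0F 3F = true
pawAdj 1F 0F = true
pawAdj 2F 0F = true
pawAdj 3F 0F = true
pawAdj 1F 2F = true
pawAdj 2F 1F = true
pawAdj _  _  = false

paw : Graph 4
paw = record { adj = pawAdj ; sym = s ; irref = i }
  where
  s : ∀ x y → pawAdj x y ≡ pawAdj y x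
  s 0F 0F = refl
  s 0F 1F = refl
  s 0F 2F = refl
  s 0F 3F = refl
  s 1F 0F = refl
  s 1F 1F = refl
  s 1F 2F = refl
  s 1F 3F = refl
  s 2F 0F = refl
  s 2F 1F = refl
  s 2F 2F = refl
  s 2F 3F = refl
  s 3F 0F = refl
  s 3F 1F = refl
  s 3F 2F = refl
  s 3F 3F = refl
  i : ∀ x → pawAdj x x ≡ false
  i 0F = refl
  i 1F = refl
  i 2F = refl
  i 3F = refl

-- Trigraphs on vertex set Fin n.  The colour of the unordered pair {x,y}
-- (x ≠ y) is  colour x y = colour y x ; diagonal values are irrelevant.

data Colour : Set where
  black white gray : Colour

record Trigraph (n : ℕ) : Set where
  field
    colour : Fin n → Fin n → Colour
    csym   : ∀ x y → colour x y ≡ colour y x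
open Trigraph public

Realizes : {n : ℕ} → Graph n → Trigraph n → Set
Realizes G T = ∀ x y → x ≢ y →
  (colour T x y ≡ black → adj G x y ≡ true) ×
  (colour T x y ≡ white → adj G x y ≡ false)

SomeRealizationHas : {k n : ℕ} → Graph k → Trigraph n → Set
SomeRealizationHas H T = Σ (Graph _) λ G → Realizes G T × HasInduced H G

samePair : {n : ℕ} → Fin n → Fin n → Fin n → Fin n → Bool
samePair u v x y = (⌊ x ≟ u ⌋ ∧ ⌊ y ≟ v ⌋) ∨ (⌊ x ≟ v ⌋ ∧ ⌊ y ≟ u ⌋)

samePair-sym : {n : ℕ} (u v x y : Fin n) → samePair u v x y ≡ samePair u v y x
samePair-sym u v x y
  rewrite ∧-comm ⌊ x ≟ u ⌋ ⌊ y ≟ v ⌋ | ∧-comm ⌊ x ≟ v ⌋ ⌊ y ≟ u ⌋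
  = ∨-comm (⌊ y ≟ v ⌋ ∧ ⌊ x ≟ u ⌋) (⌊ y ≟ u ⌋ ∧ ⌊ x ≟ v ⌋)

makeGray : {n : ℕ} → Trigraph n → Fin n → Fin n → Trigraph n
makeGray T u v = record
  { colour = λ x y → if samePair u v x y then gray else colour T x y
  ; csym   = λ x y → cong₂ (λ b c → if b then gray else c)
                       (samePair-sym u v x y) (csym T x y)
  }

InducedSaturated : {k n : ℕ} → Graph k → Trigraph n → Set
InducedSaturated H T =
  (¬ SomeRealizationHas H T) ×
  (∀ u v → u ≢ v → colour T u v ≢ gray → SomeRealizationHas H (makeGray T u v))

isGray : Colour → Bool
isGray gray = true
isGray _    = false

grayPair : {n : ℕ} → Trigraph n → Fin n → Fin n → ℕ
grayPair T x y = if ⌊ toℕ x <? toℕ y ⌋ ∧ isGray (colour T x y) then 1 else 0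

grayCount : {n : ℕ} → Trigraph n → ℕ
grayCount {n} T = sum (map (λ x → sum (map (grayPair T x) (allFin n))) (allFin n))

IndsatIs : ℕ → {k : ℕ} → Graph k → ℕ → Set
IndsatIs n H m =
  (Σ (Trigraph n) λ T → InducedSaturated H T × grayCount T ≡ m) ×
  (∀ (T : Trigraph n) → InducedSaturated H T → m ≤ grayCount T)

-- The lower bound 0 is trivial, so it suffices to find a saturated trigraph without
-- gray pairs.  Such a trigraph is just a graph G, and it is paw-induced-saturated
-- exactly when G is paw-free but toggling any single pair of G creates an induced
-- paw.  The complete multipartite graph K_{1,3,n-4} is such a graph: it is paw-free
-- because non-adjacency is an equivalence relation on it.  Adding an edge uv inside
-- a part gives the paw with a vertex w of another part as centre and leaves u, v and
-- a third vertex x of the part of u and v (this needs parts of size at least 3).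
-- Deleting an edge uv between two parts, with u not the singleton part, gives the
-- paw with centre w in the third part and leaves v, u and another vertex c of the
-- part of u.
module Submission where

open import Defs
open import Data.Nat using (ℕ; _≤_; _+_; z≤n; s≤s)
open import Data.Nat.ListAction using (sum)
open import Data.Fin using (Fin; suc; _≟_)
open import Data.Fin.Patterns using (0F; 1F; 2F; 3F; 4F; 5F; 6F)
open import Data.Bool using (true; false; _∧_; if_then_else_; not)
open import Data.Bool.Properties using (∧-zeroʳ; ∨-comm)
open import Data.List using (List; []; _∷_; map; allFin)
open import Data.Product using (Σ; _×_; _,_)
open import Data.Sum using (_⊎_; inj₁; inj₂)
open import Data.Empty using (⊥-elim)
open import Relation.Nullary using (¬_; yes; no; does)
open import Relation.Nullary.Decidable using (⌊_⌋; dec-true; dec-false)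
open import Relation.Binary.PropositionalEquality
  using (_≡_; _≢_; refl; trans; cong; cong₂; ≢-sym)
  renaming (sym to ≡-sym)

adj⇒≢ : ∀ {n} (G : Graph n) {x y} → adj G x y ≡ true → x ≢ y
adj⇒≢ G {x} xy refl with () ← trans (≡-sym (irref G x)) xy

-- The four vertices are automatically distinct: two of them that are equal
-- would have the same neighbourhood, which the adjacency pattern rules out.
paw-copy : ∀ {n} (G : Graph n) {w b c a : Fin n} →
  adj G w b ≡ true → adj G w c ≡ true → adj G w a ≡ true →
  adj G b c ≡ true → adj G b a ≡ false → adj G c a ≡ false →
  InducedCopy paw G
paw-copy G {w} {b} {c} {a} wb wc wa bc ba ca =
  record { emb = emb′ ; emb-inj = inj ; emb-adj = emb-adj′ }
  where
  emb′ : Fin 4 → Fin _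
  emb′ 0F = w
  emb′ 1F = b
  emb′ 2F = c
  emb′ 3F = a

  b≢a : b ≢ a
  b≢a refl with () ← trans (≡-sym bc) (trans (Graph.sym G b c) ca)

  c≢a : c ≢ a
  c≢a refl with () ← trans (≡-sym bc) ba

  inj : ∀ {i j} → emb′ i ≡ emb′ j → i ≡ j
  inj {0F} {0F} _ = refl
  inj {0F} {1F} e = ⊥-elim (adj⇒≢ G wb e)
  inj {0F} {2F} e = ⊥-elim (adj⇒≢ G wc e)
  inj {0F} {3F} e = ⊥-elim (adj⇒≢ G wa e)
  inj {1F} {0F} e = ⊥-elim (adj⇒≢ G wb (≡-sym e))
  inj {1F} {1F} _ = refl
  inj {1F} {2F} e = ⊥-elim (adj⇒≢ G bc e)
  inj {1F} {3F} e = ⊥-elim (b≢a e)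
  inj {2F} {0F} e = ⊥-elim (adj⇒≢ G wc (≡-sym e))
  inj {2F} {1F} e = ⊥-elim (adj⇒≢ G bc (≡-sym e))
  inj {2F} {2F} _ = refl
  inj {2F} {3F} e = ⊥-elim (c≢a e)
  inj {3F} {0F} e = ⊥-elim (adj⇒≢ G wa (≡-sym e))
  inj {3F} {1F} e = ⊥-elim (b≢a (≡-sym e))
  inj {3F} {2F} e = ⊥-elim (c≢a (≡-sym e))
  inj {3F} {3F} _ = refl

  flip : ∀ {x y β} → adj G x y ≡ β → adj G y x ≡ β
  flip {x} {y} e = trans (Graph.sym G y x) e

  emb-adj′ : ∀ i j → adj G (emb′ i) (emb′ j) ≡ adj paw i j
  emb-adj′ 0F 0F = irref G w
  emb-adj′ 0F 1F = wb
  emb-adj′ 0F 2F = wc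
  emb-adj′ 0F 3F = wa
  emb-adj′ 1F 0F = flip wb
  emb-adj′ 1F 1F = irref G b
  emb-adj′ 1F 2F = bc
  emb-adj′ 1F 3F = ba
  emb-adj′ 2F 0F = flip wc
  emb-adj′ 2F 1F = flip bc
  emb-adj′ 2F 2F = irref G c
  emb-adj′ 2F 3F = ca
  emb-adj′ 3F 0F = flip wa
  emb-adj′ 3F 1F = flip ba
  emb-adj′ 3F 2F = flip ca
  emb-adj′ 3F 3F = irref G a

inducedCopy-resp : ∀ {k n} {H : Graph k} {G G′ : Graph n} →
  (∀ x y → adj G x y ≡ adj G′ x y) → InducedCopy H G → InducedCopy H G′
inducedCopy-resp {G = G} G≗G′ C = record
  { emb     = emb C
  ; emb-inj = emb-inj C
  ; emb-adj = λ a b → trans (≡-sym (G≗G′ (emb C a) (emb C b))) (emb-adj C a b)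
  }

trigraphOf : ∀ {n} → Graph n → Trigraph n
trigraphOf G = record
  { colour = λ x y → if adj G x y then black else white
  ; csym   = λ x y → cong (if_then black else white) (Graph.sym G x y)
  }

trigraphOf-realizes : ∀ {n} (G : Graph n) → Realizes G (trigraphOf G)
trigraphOf-realizes G x y _ with adj G x y
... | true  = (λ _ → refl) , λ ()
... | false = (λ ()) , λ _ → refl

trigraphOf-realization : ∀ {n} {G G′ : Graph n} → Realizes G′ (trigraphOf G) →
  ∀ x y → adj G′ x y ≡ adj G x y
trigraphOf-realization {G = G} {G′} R x y with x ≟ y
... | yes refl = trans (irref G′ x) (≡-sym (irref G x))
... | no x≢y with adj G x y | R x y x≢y
...   | true  | black⇒edge , _ = black⇒edge refl
...   | false | _ , white⇒nonedge = white⇒nonedge refl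

sum-map-zero : ∀ {A : Set} (f : A → ℕ) (xs : List A) → (∀ x → f x ≡ 0) → sum (map f xs) ≡ 0
sum-map-zero f []       _  = refl
sum-map-zero f (x ∷ xs) f≡0 = cong₂ _+_ (f≡0 x) (sum-map-zero f xs f≡0)

grayCount-trigraphOf : ∀ {n} (G : Graph n) → grayCount (trigraphOf G) ≡ 0
grayCount-trigraphOf {n} G =
  sum-map-zero _ (allFin n) λ x → sum-map-zero _ (allFin n) λ y →
    cong (if_then 1 else 0) (trans (cong (_ ∧_) (notGray x y)) (∧-zeroʳ _))
  where
  notGray : ∀ x y → isGray (colour (trigraphOf G) x y) ≡ false
  notGray x y with adj G x y
  ... | true  = refl
  ... | false = refl

module _ {n : ℕ} (u v : Fin n) where

  samePair-swap : ∀ x y → samePair u v x y ≡ samePair v u x y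
  samePair-swap x y = ∨-comm (⌊ x ≟ u ⌋ ∧ ⌊ y ≟ v ⌋) (⌊ x ≟ v ⌋ ∧ ⌊ y ≟ u ⌋)

  samePair-self : samePair u v u v ≡ true
  samePair-self with u ≟ u | v ≟ v
  ... | yes _ | yes _ = refl
  ... | no u≢u | _     = ⊥-elim (u≢u refl)
  ... | yes _ | no v≢v = ⊥-elim (v≢v refl)

  samePair-outˡ : ∀ {x} y → x ≢ u → x ≢ v → samePair u v x y ≡ false
  samePair-outˡ {x} y x≢u x≢v with x ≟ u | x ≟ v
  ... | no _  | no _  = refl
  ... | yes e | _     = ⊥-elim (x≢u e)
  ... | no _  | yes e = ⊥-elim (x≢v e)

  samePair-outʳ : ∀ x {y} → y ≢ u → y ≢ v → samePair u v x y ≡ false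
  samePair-outʳ x {y} y≢u y≢v = trans (samePair-sym u v x y) (samePair-outˡ x y≢u y≢v)

  samePair-diag : u ≢ v → ∀ x → samePair u v x x ≡ false
  samePair-diag u≢v x with x ≟ u | x ≟ v
  ... | yes refl | yes refl = ⊥-elim (u≢v refl)
  ... | yes _    | no _     = refl
  ... | no _     | yes _    = refl
  ... | no _     | no _     = refl

toggle : ∀ {n} → Graph n → {u v : Fin n} → u ≢ v → Graph n
toggle G {u} {v} u≢v = record
  { adj   = λ x y → if samePair u v x y then not (adj G x y) else adj G x y
  ; sym   = λ x y → cong₂ (λ s e → if s then not e else e)
                          (samePair-sym u v x y) (Graph.sym G x y)
  ; irref = λ x → trans (cong (λ s → if s then not (adj G x x) else adj G x x)
                              (samePair-diag u v u≢v x))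
                        (irref G x)
  }

module _ {n} (G : Graph n) {u v : Fin n} (u≢v : u ≢ v) where

  toggle-in : ∀ {x y} → samePair u v x y ≡ true → adj (toggle G u≢v) x y ≡ not (adj G x y)
  toggle-in {x} {y} s = cong (λ s → if s then not (adj G x y) else adj G x y) s

  toggle-out : ∀ {x y} → samePair u v x y ≡ false → adj (toggle G u≢v) x y ≡ adj G x y
  toggle-out {x} {y} s = cong (λ s → if s then not (adj G x y) else adj G x y) s

  toggle-swap : ∀ x y → adj (toggle G u≢v) x y ≡ adj (toggle G (≢-sym u≢v)) x y
  toggle-swap x y =
    cong (λ s → if s then not (adj G x y) else adj G x y) (samePair-swap u v x y)

  toggle-realizes : ∀ {T} → Realizes G T → Realizes (toggle G u≢v) (makeGray T u v)
  toggle-realizes R x y x≢y with samePair u v x y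
  ... | true  = (λ ()) , (λ ())
  ... | false = R x y x≢y

trigraphOf-saturated : ∀ {k n} {H : Graph k} (G : Graph n) → ¬ HasInduced H G →
  (∀ {u v} (u≢v : u ≢ v) → HasInduced H (toggle G u≢v)) →
  InducedSaturated H (trigraphOf G)
trigraphOf-saturated {H = H} G H-free toggle-H = realizations-H-free , λ u v u≢v _ →
  toggle G u≢v , toggle-realizes G u≢v {trigraphOf G} (trigraphOf-realizes G) , toggle-H u≢v
  where
  realizations-H-free : ¬ SomeRealizationHas H (trigraphOf G)
  realizations-H-free (G′ , R , C) = H-free (inducedCopy-resp (trigraphOf-realization {G = G} {G′} R) C)

module CompleteMultipartite {n k : ℕ} (part : Fin n → Fin k) where

  completeMultipartite : Graph n
  completeMultipartite = record
    { adj   = λ x y → not (does (part x ≟ part y))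
    ; sym   = λ x y → cong not (does-sym (part x) (part y))
    ; irref = λ x → cong not (dec-true (part x ≟ part x) refl)
    }
    where
    does-sym : ∀ i j → does (i ≟ j) ≡ does (j ≟ i)
    does-sym i j with i ≟ j | j ≟ i
    ... | yes _    | yes _    = refl
    ... | no _     | no _     = refl
    ... | yes refl | no j≢i   = ⊥-elim (j≢i refl)
    ... | no i≢j   | yes refl = ⊥-elim (i≢j refl)

  private
    G = completeMultipartite

  adj-samePart : ∀ {x y} → part x ≡ part y → adj G x y ≡ false
  adj-samePart {x} {y} e = cong not (dec-true (part x ≟ part y) e)

  adj-otherPart : ∀ {x y} → part x ≢ part y → adj G x y ≡ true
  adj-otherPart {x} {y} e = cong not (dec-false (part x ≟ part y) e)

  nonadj⇒samePart : ∀ {x y} → adj G x y ≡ false → part x ≡ part y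
  nonadj⇒samePart {x} {y} nonadj with part x ≟ part y
  ... | yes e = e
  ... | no _  with () ← nonadj

  paw-free : ¬ InducedCopy paw G
  paw-free C with () ← trans (≡-sym (emb-adj C 1F 2F)) (adj-samePart
    (trans (nonadj⇒samePart (emb-adj C 1F 3F)) (≡-sym (nonadj⇒samePart (emb-adj C 2F 3F)))))

  private
    otherPart⇒≢ : ∀ {x y} → part x ≢ part y → x ≢ y
    otherPart⇒≢ ne refl = ne refl

  toggle-samePart-paw : ∀ {u v x w} (u≢v : u ≢ v) → part u ≡ part v →
    part x ≡ part u → x ≢ u → x ≢ v → part w ≢ part u →
    InducedCopy paw (toggle G u≢v)
  toggle-samePart-paw {u} {v} {x} {w} u≢v uv xu x≢u x≢v wu =
    paw-copy (toggle G u≢v)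
      (trans (outside-w u) (adj-otherPart wu))
      (trans (outside-w v) (adj-otherPart (λ e → wu (trans e (≡-sym uv)))))
      (trans (outside-w x) (adj-otherPart (λ e → wu (trans e xu))))
      (trans (toggle-in G u≢v (samePair-self u v)) (cong not (adj-samePart uv)))
      (trans (toggle-out G u≢v (samePair-outʳ u v u x≢u x≢v)) (adj-samePart (≡-sym xu)))
      (trans (toggle-out G u≢v (samePair-outʳ u v v x≢u x≢v))
             (adj-samePart (trans (≡-sym uv) (≡-sym xu))))
    where
    outside-w : ∀ y → adj (toggle G u≢v) w y ≡ adj G w y
    outside-w y = toggle-out G u≢v (samePair-outˡ u v y
      (otherPart⇒≢ wu) (otherPart⇒≢ (λ e → wu (trans e (≡-sym uv)))))

  toggle-otherPart-paw : ∀ {u v c w} (u≢v : u ≢ v) → part u ≢ part v →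
    part c ≡ part u → c ≢ u → part w ≢ part u → part w ≢ part v →
    InducedCopy paw (toggle G u≢v)
  toggle-otherPart-paw {u} {v} {c} {w} u≢v uv cu c≢u wu wv =
    paw-copy (toggle G u≢v)
      (trans (outside-w v) (adj-otherPart wv))
      (trans (outside-w c) (adj-otherPart (λ e → wu (trans e cu))))
      (trans (outside-w u) (adj-otherPart wu))
      (trans (toggle-out G u≢v (samePair-outʳ u v v c≢u c≢v))
             (adj-otherPart (λ e → uv (≡-sym (trans e cu)))))
      (trans (toggle-in G u≢v (trans (samePair-swap u v v u) (samePair-self v u)))
             (cong not (adj-otherPart (≢-sym uv))))
      (trans (toggle-out G u≢v (samePair-outˡ u v u c≢u c≢v)) (adj-samePart cu))
    where
    c≢v : c ≢ v
    c≢v refl = uv (≡-sym cu)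

    outside-w : ∀ y → adj (toggle G u≢v) w y ≡ adj G w y
    outside-w y = toggle-out G u≢v (samePair-outˡ u v y (otherPart⇒≢ wu) (otherPart⇒≢ wv))

module _ {n : ℕ} {P : Fin n → Set} {u v : Fin n} where

  private
    avoids? : ∀ x → (x ≢ u × x ≢ v) ⊎ (x ≡ u ⊎ x ≡ v)
    avoids? x with x ≟ u | x ≟ v
    ... | yes x≡u | _      = inj₂ (inj₁ x≡u)
    ... | no _    | yes x≡v = inj₂ (inj₂ x≡v)
    ... | no x≢u  | no x≢v  = inj₁ (x≢u , x≢v)

    third-avoids : ∀ {a b c} → a ≡ u ⊎ a ≡ v → b ≡ u ⊎ b ≡ v → a ≢ b →
      c ≢ a → c ≢ b → c ≢ u × c ≢ v
    third-avoids (inj₁ refl) (inj₁ refl) a≢b _ _ = ⊥-elim (a≢b refl)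
    third-avoids (inj₂ refl) (inj₂ refl) a≢b _ _ = ⊥-elim (a≢b refl)
    third-avoids (inj₁ refl) (inj₂ refl) _ c≢a c≢b = c≢a , c≢b
    third-avoids (inj₂ refl) (inj₁ refl) _ c≢a c≢b = c≢b , c≢a

  one-of-three-avoids : ∀ {a b c} → P a → P b → P c → a ≢ b → a ≢ c → b ≢ c →
    Σ (Fin n) λ x → P x × x ≢ u × x ≢ v
  one-of-three-avoids {a} {b} {c} Pa Pb Pc a≢b a≢c b≢c with avoids? a | avoids? b
  ... | inj₁ a-avoids | _           = a , Pa , a-avoids
  ... | inj₂ _        | inj₁ b-avoids = b , Pb , b-avoids
  ... | inj₂ a∈       | inj₂ b∈     =
    c , Pc , third-avoids a∈ b∈ a≢b (≢-sym a≢c) (≢-sym b≢c)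

-- The partition of n ≥ 7 vertices into parts {0}, {1,2,3} and {4,…,n-1}

module K₁₃ (m : ℕ) where

  part : Fin (7 + m) → Fin 3
  part 0F = 0F
  part 1F = 1F
  part 2F = 1F
  part 3F = 1F
  part (suc (suc (suc (suc _)))) = 2F

  open CompleteMultipartite part public

  part-singleton : ∀ {x} → part x ≡ 0F → x ≡ 0F
  part-singleton {0F} _ = refl
  part-singleton {1F} ()
  part-singleton {2F} ()
  part-singleton {3F} ()
  part-singleton {suc (suc (suc (suc _)))} ()

  part-avoid : ∀ i → i ≢ 0F → ∀ u v → Σ (Fin (7 + m)) λ x → part x ≡ i × x ≢ u × x ≢ v
  part-avoid 0F i≢0 _ _ = ⊥-elim (i≢0 refl)
  part-avoid 1F _ u v =
    one-of-three-avoids {a = 1F} {2F} {3F} refl refl refl (λ ()) (λ ()) (λ ())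
  part-avoid 2F _ u v =
    one-of-three-avoids {a = 4F} {5F} {6F} refl refl refl (λ ()) (λ ()) (λ ())

  part-other : ∀ i j → Σ (Fin (7 + m)) λ w → part w ≢ i × part w ≢ j
  part-other i j
    with k , (w , refl) , k≢i , k≢j ←
      one-of-three-avoids {P = λ k → Σ (Fin (7 + m)) λ w → part w ≡ k}
        {a = 0F} {1F} {2F} (0F , refl) (1F , refl) (4F , refl) (λ ()) (λ ()) (λ ())
    = w , k≢i , k≢j

  toggle-paw : ∀ {u v} (u≢v : u ≢ v) → HasInduced paw (toggle completeMultipartite u≢v)
  toggle-paw {u} {v} u≢v
    with part u ≟ part v | part u ≟ 0F | part v ≟ 0F
  ... | yes uv | yes u₀ | _ = ⊥-elim (u≢v (trans (part-singleton u₀)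
                                                (≡-sym (part-singleton (trans (≡-sym uv) u₀)))))
  ... | yes uv | no u≢₀ | _
    with x , xu , x≢u , x≢v ← part-avoid _ u≢₀ u v
       | w , wu , _ ← part-other (part u) (part u)
    = toggle-samePart-paw u≢v uv xu x≢u x≢v wu
  ... | no uv | no u≢₀ | _
    with c , cu , c≢u , _ ← part-avoid _ u≢₀ u v
       | w , wu , wv ← part-other (part u) (part v)
    = toggle-otherPart-paw u≢v uv cu c≢u wu wv
  ... | no uv | yes _ | no v≢₀
    with c , cv , c≢v , _ ← part-avoid _ v≢₀ v u
       | w , wv , wu ← part-other (part v) (part u)
    = inducedCopy-resp (toggle-swap completeMultipartite (≢-sym u≢v))
        (toggle-otherPart-paw (≢-sym u≢v) (≢-sym uv) cv c≢v wv wu)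
  ... | no uv | yes u₀ | yes v₀ = ⊥-elim (uv (trans u₀ (≡-sym v₀)))

corollary2p3 : ∀ (n : ℕ) → 7 ≤ n → IndsatIs n paw 0
corollary2p3 _ (s≤s (s≤s (s≤s (s≤s (s≤s (s≤s (s≤s (z≤n {m})))))))) =
  (trigraphOf completeMultipartite , saturated , grayCount-trigraphOf completeMultipartite) ,
  λ _ _ → z≤n
  where
  open K₁₃ m

  saturated : InducedSaturated paw (trigraphOf completeMultipartite)
  saturated = trigraphOf-saturated completeMultipartite paw-free toggle-paw
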